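{- Let $P\subset\mathbb{R}^3$ be a lattice polytope with $\Delta_P(x)=l_1\leq\Delta_P(y)=l_2\leq\Delta_P(z)=l$, where $l_1\geq1$. Let $S$ be the set of all pairs $(a,b)\in\mathbb{Z}^2$ such that: (1) if $|a|\geq|b|$ then $|b|\leq\frac{2l-1}{l_2}$ and $|a|\leq\frac{2l-1+|b|l_2}{l_1}$; and (2) if $|b|\geq|a|$ then $|a|\leq\frac{2l-1}{l_1}$ and $|b|\leq\frac{2l-1+|a|l_1}{l_2}$. Suppose that $\Delta_P(x+y)\geq l_2$, $\Delta_P(x-y)\geq l_2$, and $\Delta_P(ax+by+z)\geq l$ for all $(a,b)\in S$. Then ${\rm ls}_\square(P)=l$.
   Context: A lattice polytope is the convex hull of finitely many points of $\mathbb{Z}^3$. For a linear function $f$ with integer coefficients, $\Delta_P(f)=\max_{p\in P}f(p)-\min_{p\in P}f(p)$. An affine unimodular transformation is $T(p)=Ap+v$ with $A\in\mathbb{Z}^{3\times3}$, $\det A=\pm1$, $v\in\mathbb{Z}^3$. The lattice size ${\rm ls}_\square(P)$ is the smallest integer $k$ such that $T(P)\subseteq[0,k]^3$ for some affine unimodular transformation $T$. -}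

module Defs where

open import Data.Nat using (ℕ)
open import Data.Integer using (ℤ; +_; -_; _+_; _-_; _*_; _≤_; _⊔_; _⊓_; ∣_∣)
open import Data.Fin using (Fin; zero; suc)
open import Data.Product using (Σ; _×_)
open import Data.Sum using (_⊎_)
open import Data.List.NonEmpty using (List⁺; toList; foldr₁; map)
open import Data.List.Relation.Unary.All using (All)
open import Relation.Binary.PropositionalEquality using (_≡_)

-- Points of ℤ³ and integer linear functionals (given by their coefficients).
Pt : Set
Pt = Fin 3 → ℤ

-- A lattice polytope P = conv(V) is represented by a nonempty finite list V
-- of lattice points spanning it.
LatticePolytope : Set
LatticePolytope = List⁺ Pt

evalLin : Pt → Pt → ℤ
evalLin c p = c zero * p zero + c (suc zero) * p (suc zero) + c (suc (suc zero)) * p (suc (suc zero))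

-- max/min of a linear function over conv(V) is attained on V
maxOn : LatticePolytope → Pt → ℤ
maxOn P c = foldr₁ _⊔_ (map (evalLin c) P)

minOn : LatticePolytope → Pt → ℤ
minOn P c = foldr₁ _⊓_ (map (evalLin c) P)

Δ : LatticePolytope → Pt → ℤ
Δ P c = maxOn P c - minOn P c

-- coefficient vector (a,b,c) of the linear function a x + b y + c z
vec3 : ℤ → ℤ → ℤ → Pt
vec3 a b c zero = a
vec3 a b c (suc zero) = b
vec3 a b c (suc (suc zero)) = c

Mat : Set
Mat = Fin 3 → Fin 3 → ℤ

det3 : Mat → ℤ
det3 A =
    A 0' 0' * (A 1' 1' * A 2' 2' - A 1' 2' * A 2' 1')
  - A 0' 1' * (A 1' 0' * A 2' 2' - A 1' 2' * A 2' 0')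
  + A 0' 2' * (A 1' 0' * A 2' 1' - A 1' 1' * A 2' 0')
  where
  0' 1' 2' : Fin 3
  0' = zero
  1' = suc zero
  2' = suc (suc zero)

Unimodular : Mat → Set
Unimodular A = (det3 A ≡ + 1) ⊎ (det3 A ≡ - (+ 1))

affine : Mat → Pt → Pt → Pt
affine A v p i = evalLin (A i) p + v i

InCube : ℕ → Pt → Set
InCube k q = ∀ i → (+ 0 ≤ q i) × (q i ≤ + k)

-- T(P) ⊆ [0,k]³ for T = (A , v)  (equivalently: all generators land in the cube,
-- since the cube is convex)
FitsInCube : LatticePolytope → ℕ → Mat → Pt → Set
FitsInCube P k A v = All (λ p → InCube k (affine A v p)) (toList P)

IsLatticeSize : LatticePolytope → ℕ → Set
IsLatticeSize P k =
  (Σ Mat λ A → Σ Pt λ v → Unimodular A × FitsInCube P k A v)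
  × (∀ (m : ℕ) (A : Mat) (v : Pt) → Unimodular A → FitsInCube P m A v → k Data.Nat.≤ m)

module Submission where

open import Defs
open import Data.Nat using (ℕ; _∸_; _≤_)
open import Data.Integer using (ℤ; +_; -_; ∣_∣)
open import Data.Product using (_×_)
open import Relation.Binary.PropositionalEquality using (_≡_)

open import Data.Nat using (zero; suc; _+_; _*_; _≤?_; z≤n)
import Data.Nat.Properties as ℕP
open import Data.Integer using (-[1+_]; +≤+)
  renaming (_+_ to _+ᶻ_; _-_ to _-ᶻ_; _*_ to _*ᶻ_; _≤_ to _≤ᶻ_)
import Data.Integer.Properties as ℤP
open import Data.Integer.DivMod using (_/ℕ_; _%ℕ_; a≡a%ℕn+[a/ℕn]*n; n%ℕd<d)
open import Data.Integer.Tactic.RingSolver using (solve-∀)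
open import Data.Fin using (zero; suc)
open import Data.List using ([]; _∷_)
open import Data.List.NonEmpty using (_∷_; toList)
open import Data.List.Membership.Propositional using (_∈_)
open import Data.List.Relation.Unary.Any using (here; there)
open import Data.List.Relation.Unary.All using (tabulate; lookup)
open import Data.Product using (∃-syntax; _,_; proj₁; proj₂)
open import Data.Sum using (_⊎_; inj₁; inj₂; map; map₁)
open import Relation.Nullary using (¬_; Dec; yes; no; contradiction)
open import Data.Empty using (⊥; ⊥-elim)
open import Relation.Binary.PropositionalEquality
  using (refl; sym; trans; cong; cong₂; _≗_)

-- For a functional c write  width P c = Δ_P(c) ∈ ℕ.  The argument rests on one
-- geometric fact: width is a seminorm on functionals, i.e. it is invariant under
-- pointwise equality, subadditive and absolutely homogeneous.  Consequently every
-- integer relation  s·h = f + t·g (+ u·k)  between functionals gives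
-- |s|·width h ≤ width f + |t|·width g (+ |u|·width k).
--  * Upper bound: translating P by its minima fits it into [0,l]³ (identity matrix).
--  * Lower bound: a unimodular matrix has a row (f₀,f₁,g) with g odd (else det3 is
--    even).  Rounding f₀/g, f₁/g to n, m with error ≤ (|g|-1)/2 and writing
--    g·(n x + m y + z) = f + t x + u y shows width f ≥ l as soon as every
--    functional a x + b y + z has width ≥ l.
--  * That last fact is the hypothesis for (a,b) ∈ S; for (a,b) ∉ S the relations
--    between a x + b y, x, y and x ± y force width(a x + b y) ≥ 2l, hence
--    width(a x + b y + z) ≥ 2l - width z = l.

pattern 0F = zero
pattern 1F = suc zero
pattern 2F = suc (suc zero)

X Y Z : Pt
X = vec3 (+ 1) (+ 0) (+ 0)
Y = vec3 (+ 0) (+ 1) (+ 0)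
Z = vec3 (+ 0) (+ 0) (+ 1)

infixl 6 _⊕_
infixr 7 _⊛_

_⊕_ : Pt → Pt → Pt
(f ⊕ g) i = f i +ᶻ g i

_⊛_ : ℤ → Pt → Pt
(s ⊛ f) i = s *ᶻ f i

coordinates : ∀ f → f ≗ f 0F ⊛ X ⊕ f 1F ⊛ Y ⊕ f 2F ⊛ Z
coordinates f 0F = first (f 0F) (f 1F) (f 2F)
  where
  first : ∀ p q r → p ≡ p *ᶻ + 1 +ᶻ q *ᶻ + 0 +ᶻ r *ᶻ + 0
  first = solve-∀
coordinates f 1F = second (f 0F) (f 1F) (f 2F)
  where
  second : ∀ p q r → q ≡ p *ᶻ + 0 +ᶻ q *ᶻ + 1 +ᶻ r *ᶻ + 0
  second = solve-∀
coordinates f 2F = third (f 0F) (f 1F) (f 2F)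
  where
  third : ∀ p q r → r ≡ p *ᶻ + 0 +ᶻ q *ᶻ + 0 +ᶻ r *ᶻ + 1
  third = solve-∀

sum-coords : vec3 (+ 1) (+ 1) (+ 0) ≗ X ⊕ + 1 ⊛ Y
sum-coords 0F = refl
sum-coords 1F = refl
sum-coords 2F = refl

difference-coords : vec3 (+ 1) (- (+ 1)) (+ 0) ≗ X ⊕ - (+ 1) ⊛ Y
difference-coords 0F = refl
difference-coords 1F = refl
difference-coords 2F = refl

spread : Pt → Pt → Pt → ℤ
spread c q r = evalLin c q -ᶻ evalLin c r

maxOn-upper : ∀ p ps c {q} → q ∈ toList (p ∷ ps) → evalLin c q ≤ᶻ maxOn (p ∷ ps) c
maxOn-upper p [] c (here refl) = ℤP.≤-refl
maxOn-upper p (r ∷ rs) c (here refl) = ℤP.i≤i⊔j _ _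
maxOn-upper p (r ∷ rs) c (there q∈) = ℤP.≤-trans (maxOn-upper r rs c q∈) (ℤP.i≤j⊔i _ _)

minOn-lower : ∀ p ps c {q} → q ∈ toList (p ∷ ps) → minOn (p ∷ ps) c ≤ᶻ evalLin c q
minOn-lower p [] c (here refl) = ℤP.≤-refl
minOn-lower p (r ∷ rs) c (here refl) = ℤP.i⊓j≤i _ _
minOn-lower p (r ∷ rs) c (there q∈) = ℤP.≤-trans (ℤP.i⊓j≤j _ _) (minOn-lower r rs c q∈)

maxOn-attained : ∀ p ps c → ∃[ q ] q ∈ toList (p ∷ ps) × maxOn (p ∷ ps) c ≡ evalLin c q
maxOn-attained p [] c = p , here refl , refl
maxOn-attained p (r ∷ rs) c with evalLin c p ℤP.≤? maxOn (r ∷ rs) c | maxOn-attained r rs c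
... | yes p≤max | q , q∈ , eq = q , there q∈ , trans (ℤP.i≤j⇒i⊔j≡j p≤max) eq
... | no p≰max  | _ = p , here refl , ℤP.i≥j⇒i⊔j≡i (ℤP.<⇒≤ (ℤP.≰⇒> p≰max))

minOn-attained : ∀ p ps c → ∃[ q ] q ∈ toList (p ∷ ps) × minOn (p ∷ ps) c ≡ evalLin c q
minOn-attained p [] c = p , here refl , refl
minOn-attained p (r ∷ rs) c with evalLin c p ℤP.≤? minOn (r ∷ rs) c | minOn-attained r rs c
... | yes p≤min | _ = p , here refl , ℤP.i≤j⇒i⊓j≡i p≤min
... | no p≰min  | q , q∈ , eq = q , there q∈ , trans (ℤP.i≥j⇒i⊓j≡j (ℤP.<⇒≤ (ℤP.≰⇒> p≰min))) eq

spread≤Δ : ∀ P c {q r} → q ∈ toList P → r ∈ toList P → spread c q r ≤ᶻ Δ P c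
spread≤Δ (p ∷ ps) c q∈ r∈ =
  ℤP.+-mono-≤ (maxOn-upper p ps c q∈) (ℤP.neg-mono-≤ (minOn-lower p ps c r∈))

Δ-attained : ∀ P c → ∃[ q ] ∃[ r ] q ∈ toList P × r ∈ toList P × Δ P c ≡ spread c q r
Δ-attained (p ∷ ps) c with maxOn-attained p ps c | minOn-attained p ps c
... | q , q∈ , eq | r , r∈ , er = q , r , q∈ , r∈ , cong₂ _-ᶻ_ eq er

-- Width as a seminorm on functionals.

width : LatticePolytope → Pt → ℕ
width P c = ∣ Δ P c ∣

Δ≡width : ∀ P c → Δ P c ≡ + width P c
Δ≡width P@(p ∷ _) c = sym (ℤP.0≤i⇒+∣i∣≡i Δ≥0)
  where
  Δ≥0 : + 0 ≤ᶻ Δ P c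
  Δ≥0 = ℤP.≤-trans (ℤP.≤-reflexive (sym (ℤP.i≡j⇒i-j≡0 {evalLin c p} refl)))
                   (spread≤Δ P c (here refl) (here refl))

width≥ : ∀ P c {k} → + k ≤ᶻ Δ P c → k ≤ width P c
width≥ P c k≤Δ = ℤP.drop‿+≤+ (ℤP.≤-trans k≤Δ (ℤP.≤-reflexive (Δ≡width P c)))

∣spread∣-is-spread : ∀ c q r → + ∣ spread c q r ∣ ≡ spread c q r ⊎ + ∣ spread c q r ∣ ≡ spread c r q
∣spread∣-is-spread c q r with ℤP.≤-total (evalLin c q) (evalLin c r)
... | inj₁ q≤r = inj₂ (ℤP.∣-∣-≤ q≤r)
... | inj₂ r≤q = inj₁ (trans (cong +_ (ℤP.∣i-j∣≡∣j-i∣ (evalLin c q) (evalLin c r))) (ℤP.∣-∣-≤ r≤q))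

∣spread∣≤width : ∀ P c {q r} → q ∈ toList P → r ∈ toList P → ∣ spread c q r ∣ ≤ width P c
∣spread∣≤width P c {q} {r} q∈ r∈ = ℤP.drop‿+≤+ (ℤP.≤-trans bound (ℤP.≤-reflexive (Δ≡width P c)))
  where
  bound : + ∣ spread c q r ∣ ≤ᶻ Δ P c
  bound with ∣spread∣-is-spread c q r
  ... | inj₁ eq = ℤP.≤-trans (ℤP.≤-reflexive eq) (spread≤Δ P c q∈ r∈)
  ... | inj₂ eq = ℤP.≤-trans (ℤP.≤-reflexive eq) (spread≤Δ P c r∈ q∈)

width-least : ∀ P c {B} → (∀ {q r} → q ∈ toList P → r ∈ toList P → ∣ spread c q r ∣ ≤ B) →
  width P c ≤ B
width-least P c bound with Δ-attained P c
... | q , r , q∈ , r∈ , eq = ℕP.≤-trans (ℕP.≤-reflexive (cong ∣_∣ eq)) (bound q∈ r∈)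

spread-cong : ∀ {c d} → c ≗ d → ∀ q r → spread c q r ≡ spread d q r
spread-cong c≗d q r rewrite c≗d 0F | c≗d 1F | c≗d 2F = refl

spread-⊕ : ∀ f g q r → spread (f ⊕ g) q r ≡ spread f q r +ᶻ spread g q r
spread-⊕ f g q r =
  distrib (f 0F) (f 1F) (f 2F) (g 0F) (g 1F) (g 2F) (q 0F) (q 1F) (q 2F) (r 0F) (r 1F) (r 2F)
  where
  distrib : ∀ f₀ f₁ f₂ g₀ g₁ g₂ q₀ q₁ q₂ r₀ r₁ r₂ →
    ((f₀ +ᶻ g₀) *ᶻ q₀ +ᶻ (f₁ +ᶻ g₁) *ᶻ q₁ +ᶻ (f₂ +ᶻ g₂) *ᶻ q₂)
      -ᶻ ((f₀ +ᶻ g₀) *ᶻ r₀ +ᶻ (f₁ +ᶻ g₁) *ᶻ r₁ +ᶻ (f₂ +ᶻ g₂) *ᶻ r₂)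
    ≡ ((f₀ *ᶻ q₀ +ᶻ f₁ *ᶻ q₁ +ᶻ f₂ *ᶻ q₂) -ᶻ (f₀ *ᶻ r₀ +ᶻ f₁ *ᶻ r₁ +ᶻ f₂ *ᶻ r₂))
      +ᶻ ((g₀ *ᶻ q₀ +ᶻ g₁ *ᶻ q₁ +ᶻ g₂ *ᶻ q₂) -ᶻ (g₀ *ᶻ r₀ +ᶻ g₁ *ᶻ r₁ +ᶻ g₂ *ᶻ r₂))
  distrib = solve-∀

spread-⊛ : ∀ s c q r → spread (s ⊛ c) q r ≡ s *ᶻ spread c q r
spread-⊛ s c q r = factor s (c 0F) (c 1F) (c 2F) (q 0F) (q 1F) (q 2F) (r 0F) (r 1F) (r 2F)
  where
  factor : ∀ s c₀ c₁ c₂ q₀ q₁ q₂ r₀ r₁ r₂ →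
    ((s *ᶻ c₀) *ᶻ q₀ +ᶻ (s *ᶻ c₁) *ᶻ q₁ +ᶻ (s *ᶻ c₂) *ᶻ q₂)
      -ᶻ ((s *ᶻ c₀) *ᶻ r₀ +ᶻ (s *ᶻ c₁) *ᶻ r₁ +ᶻ (s *ᶻ c₂) *ᶻ r₂)
    ≡ s *ᶻ ((c₀ *ᶻ q₀ +ᶻ c₁ *ᶻ q₁ +ᶻ c₂ *ᶻ q₂) -ᶻ (c₀ *ᶻ r₀ +ᶻ c₁ *ᶻ r₁ +ᶻ c₂ *ᶻ r₂))
  factor = solve-∀

width-cong : ∀ P {c d} → c ≗ d → width P c ≡ width P d
width-cong P c≗d = ℕP.≤-antisym (bounded-by c≗d) (bounded-by (λ i → sym (c≗d i)))
  where
  bounded-by : ∀ {c d} → c ≗ d → width P c ≤ width P d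
  bounded-by {c} {d} c≗d = width-least P c λ {q} {r} q∈ r∈ →
    ℕP.≤-trans (ℕP.≤-reflexive (cong ∣_∣ (spread-cong c≗d q r))) (∣spread∣≤width P d q∈ r∈)

width-⊕ : ∀ P f g → width P (f ⊕ g) ≤ width P f + width P g
width-⊕ P f g = width-least P (f ⊕ g) λ {q} {r} q∈ r∈ → begin
  ∣ spread (f ⊕ g) q r ∣                ≡⟨ cong ∣_∣ (spread-⊕ f g q r) ⟩
  ∣ spread f q r +ᶻ spread g q r ∣      ≤⟨ ℤP.∣i+j∣≤∣i∣+∣j∣ (spread f q r) (spread g q r) ⟩
  ∣ spread f q r ∣ + ∣ spread g q r ∣
    ≤⟨ ℕP.+-mono-≤ (∣spread∣≤width P f q∈ r∈) (∣spread∣≤width P g q∈ r∈) ⟩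
  width P f + width P g                 ∎
  where open ℕP.≤-Reasoning

width-⊛ : ∀ P s c → width P (s ⊛ c) ≡ ∣ s ∣ * width P c
width-⊛ P s c = ℕP.≤-antisym at-most at-least
  where
  ∣spread-⊛∣ : ∀ q r → ∣ spread (s ⊛ c) q r ∣ ≡ ∣ s ∣ * ∣ spread c q r ∣
  ∣spread-⊛∣ q r = trans (cong ∣_∣ (spread-⊛ s c q r)) (ℤP.abs-* s (spread c q r))
  at-most : width P (s ⊛ c) ≤ ∣ s ∣ * width P c
  at-most = width-least P (s ⊛ c) λ {q} {r} q∈ r∈ →
    ℕP.≤-trans (ℕP.≤-reflexive (∣spread-⊛∣ q r)) (ℕP.*-monoʳ-≤ ∣ s ∣ (∣spread∣≤width P c q∈ r∈))
  at-least : ∣ s ∣ * width P c ≤ width P (s ⊛ c)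
  at-least with Δ-attained P c
  ... | q , r , q∈ , r∈ , eq = ℕP.≤-trans
    (ℕP.≤-reflexive (trans (cong (λ e → ∣ s ∣ * ∣ e ∣) eq) (sym (∣spread-⊛∣ q r))))
    (∣spread∣≤width P (s ⊛ c) q∈ r∈)

width-relation : ∀ P s t h f g → s ⊛ h ≗ f ⊕ t ⊛ g →
  ∣ s ∣ * width P h ≤ width P f + ∣ t ∣ * width P g
width-relation P s t h f g rel = begin
  ∣ s ∣ * width P h               ≡⟨ width-⊛ P s h ⟨
  width P (s ⊛ h)                 ≡⟨ width-cong P rel ⟩
  width P (f ⊕ t ⊛ g)             ≤⟨ width-⊕ P f (t ⊛ g) ⟩
  width P f + width P (t ⊛ g)     ≡⟨ cong (λ e → width P f + e) (width-⊛ P t g) ⟩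
  width P f + ∣ t ∣ * width P g   ∎
  where open ℕP.≤-Reasoning

width-relation₃ : ∀ P s t u h f g k → s ⊛ h ≗ f ⊕ t ⊛ g ⊕ u ⊛ k →
  ∣ s ∣ * width P h ≤ width P f + ∣ t ∣ * width P g + ∣ u ∣ * width P k
width-relation₃ P s t u h f g k rel = begin
  ∣ s ∣ * width P h                                   ≤⟨ width-relation P s u h (f ⊕ t ⊛ g) k rel ⟩
  width P (f ⊕ t ⊛ g) + ∣ u ∣ * width P k             ≤⟨ ℕP.+-monoˡ-≤ _ (width-⊕ P f (t ⊛ g)) ⟩
  width P f + width P (t ⊛ g) + ∣ u ∣ * width P k
    ≡⟨ cong (λ e → width P f + e + ∣ u ∣ * width P k) (width-⊛ P t g) ⟩
  width P f + ∣ t ∣ * width P g + ∣ u ∣ * width P k   ∎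
  where open ℕP.≤-Reasoning

Sign : ℤ → Set
Sign σ = σ ≡ + 1 ⊎ σ ≡ - (+ 1)

∣+-+∣ : ∀ {x y} → y ≤ x → ∣ + x -ᶻ + y ∣ ≡ x ∸ y
∣+-+∣ {x} {y} y≤x = trans (cong ∣_∣ (ℤP.m-n≡m⊖n x y)) (trans (ℤP.∣m⊖n∣≡∣n⊖m∣ x y) (ℤP.∣⊖∣-≤ y≤x))

-- For |b| ≤ |a| a sign σ can be chosen so that |aσ - b| = |a| - |b|
-- (σ = +1 when a, b have the same sign, σ = -1 otherwise).
aligning-sign : ∀ a b → ∣ b ∣ ≤ ∣ a ∣ → ∃[ σ ] Sign σ × ∣ a *ᶻ σ -ᶻ b ∣ ≡ ∣ a ∣ ∸ ∣ b ∣
aligning-sign = aligned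
  where
  same : ∀ x y → x *ᶻ + 1 -ᶻ y ≡ x -ᶻ y
  same = solve-∀
  same-neg : ∀ x y → (- x) *ᶻ + 1 -ᶻ (- y) ≡ - (x -ᶻ y)
  same-neg = solve-∀
  opposite : ∀ x y → x *ᶻ - (+ 1) -ᶻ (- y) ≡ - (x -ᶻ y)
  opposite = solve-∀
  opposite-neg : ∀ x y → (- x) *ᶻ - (+ 1) -ᶻ y ≡ x -ᶻ y
  opposite-neg = solve-∀
  aligned : ∀ a b → ∣ b ∣ ≤ ∣ a ∣ → ∃[ σ ] Sign σ × ∣ a *ᶻ σ -ᶻ b ∣ ≡ ∣ a ∣ ∸ ∣ b ∣
  aligned (+ n) (+ m) m≤n =
    + 1 , inj₁ refl , trans (cong ∣_∣ (same (+ n) (+ m))) (∣+-+∣ m≤n)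
  aligned (+ n) -[1+ m ] m<n =
    - (+ 1) , inj₂ refl ,
    trans (cong ∣_∣ (opposite (+ n) (+ suc m))) (trans (ℤP.∣-i∣≡∣i∣ (+ n -ᶻ + suc m)) (∣+-+∣ m<n))
  aligned -[1+ n ] (+ m) m≤n =
    - (+ 1) , inj₂ refl , trans (cong ∣_∣ (opposite-neg (+ suc n) (+ m))) (∣+-+∣ m≤n)
  aligned -[1+ n ] -[1+ m ] m≤n =
    + 1 , inj₁ refl ,
    trans (cong ∣_∣ (same-neg (+ suc n) (+ suc m)))
          (trans (ℤP.∣-i∣≡∣i∣ (+ suc n -ᶻ + suc m)) (∣+-+∣ m≤n))

beyond₀ : ∀ L x → ¬ (x ≤ 2 * L ∸ 1) → 2 * L ≤ x
beyond₀ zero x _ = z≤n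
beyond₀ (suc L) x x≰ = ℕP.≰⇒> x≰

beyond : ∀ L x y → ¬ (x ≤ 2 * L ∸ 1 + y) → 2 * L + y ≤ x
beyond zero x y x≰ = ℕP.<⇒≤ (ℕP.≰⇒> x≰)
beyond (suc L) x y x≰ = ℕP.≰⇒> x≰

cancel-difference : ∀ {α β} c W → β ≤ α → α * c ≤ W + (α ∸ β) * c → β * c ≤ W
cancel-difference {α} {β} c W β≤α bound = ℕP.+-cancelʳ-≤ ((α ∸ β) * c) (β * c) W (begin
  β * c + (α ∸ β) * c   ≡⟨ ℕP.*-distribʳ-+ c β (α ∸ β) ⟨
  (β + (α ∸ β)) * c     ≡⟨ cong (_* c) (ℕP.m+[n∸m]≡n β≤α) ⟩
  α * c                 ≤⟨ bound ⟩
  W + (α ∸ β) * c       ∎)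
  where open ℕP.≤-Reasoning

-- The condition defining S, in the case |b| ≤ |a|, written for the absolute
-- values α, β of the coefficients and the widths p, q of their functionals.
Small : (α β p q L : ℕ) → Set
Small α β p q L = (β * q ≤ 2 * L ∸ 1) × (α * p ≤ 2 * L ∸ 1 + β * q)

module TwoFunctionals (P : LatticePolytope) (φ ψ : Pt) (p q : ℕ)
  (wφ : width P φ ≡ p) (wψ : width P ψ ≡ q)
  (narrow : ∀ σ → Sign σ → q ≤ width P (φ ⊕ σ ⊛ ψ)) where

  comb : ℤ → ℤ → Pt
  comb a b = a ⊛ φ ⊕ b ⊛ ψ

  -- From a φ = (a φ + b ψ) - b ψ.
  trade : ∀ a b → ∣ a ∣ * p ≤ width P (comb a b) + ∣ b ∣ * q
  trade a b = begin
    ∣ a ∣ * p                                   ≡⟨ cong (∣ a ∣ *_) wφ ⟨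
    ∣ a ∣ * width P φ
      ≤⟨ width-relation P a (- b) φ (comb a b) ψ (λ i → regroup a b (φ i) (ψ i)) ⟩
    width P (comb a b) + ∣ - b ∣ * width P ψ
      ≡⟨ cong₂ (λ m n → width P (comb a b) + m * n) (ℤP.∣-i∣≡∣i∣ b) wψ ⟩
    width P (comb a b) + ∣ b ∣ * q              ∎
    where
    open ℕP.≤-Reasoning
    regroup : ∀ a b x y → a *ᶻ x ≡ (a *ᶻ x +ᶻ b *ᶻ y) +ᶻ (- b) *ᶻ y
    regroup = solve-∀

  -- The smaller coefficient is controlled: from a (φ + σ ψ) = (a φ + b ψ) + (a σ - b) ψ.
  dominated : ∀ a b → ∣ b ∣ ≤ ∣ a ∣ → ∣ b ∣ * q ≤ width P (comb a b)
  dominated a b b≤a with aligning-sign a b b≤a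
  ... | σ , σ-sign , ∣aσ-b∣ = cancel-difference q (width P (comb a b)) b≤a (begin
    ∣ a ∣ * q                                        ≤⟨ ℕP.*-monoʳ-≤ ∣ a ∣ (narrow σ σ-sign) ⟩
    ∣ a ∣ * width P (φ ⊕ σ ⊛ ψ)
      ≤⟨ width-relation P a (a *ᶻ σ -ᶻ b) (φ ⊕ σ ⊛ ψ) (comb a b) ψ
                        (λ i → regroup a b σ (φ i) (ψ i)) ⟩
    width P (comb a b) + ∣ a *ᶻ σ -ᶻ b ∣ * width P ψ
      ≡⟨ cong₂ (λ m n → width P (comb a b) + m * n) ∣aσ-b∣ wψ ⟩
    width P (comb a b) + (∣ a ∣ ∸ ∣ b ∣) * q          ∎)
    where
    open ℕP.≤-Reasoning
    regroup : ∀ a b σ x y → a *ᶻ (x +ᶻ σ *ᶻ y) ≡ (a *ᶻ x +ᶻ b *ᶻ y) +ᶻ (a *ᶻ σ -ᶻ b) *ᶻ y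
    regroup = solve-∀

  small-or-wide : ∀ L a b → ∣ b ∣ ≤ ∣ a ∣ → Small ∣ a ∣ ∣ b ∣ p q L ⊎ 2 * L ≤ width P (comb a b)
  small-or-wide L a b b≤a with ∣ b ∣ * q ≤? 2 * L ∸ 1 | ∣ a ∣ * p ≤? 2 * L ∸ 1 + ∣ b ∣ * q
  ... | yes small₁ | yes small₂ = inj₁ (small₁ , small₂)
  ... | no large₁ | _ = inj₂ (ℕP.≤-trans (beyond₀ L _ large₁) (dominated a b b≤a))
  ... | yes _ | no large₂ = inj₂ (ℕP.+-cancelʳ-≤ (∣ b ∣ * q) (2 * L) (width P (comb a b))
                                   (ℕP.≤-trans (beyond L _ _ large₂) (trade a b)))

nearest-multiple-pos : ∀ α K → ∃[ n ] ∣ + suc (K + K) *ᶻ n -ᶻ α ∣ ≤ K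
nearest-multiple-pos α K = round (α %ℕ d ≤? K)
  where
  d : ℕ
  d = suc (K + K)
  r : ℕ
  r = α %ℕ d
  quotient : ℤ
  quotient = α /ℕ d
  division : α ≡ + r +ᶻ quotient *ᶻ + d
  division = a≡a%ℕn+[a/ℕn]*n α d
  round-down : ∀ x n ρ α → α ≡ ρ +ᶻ n *ᶻ x → x *ᶻ n -ᶻ α ≡ - ρ
  round-down x n ρ _ refl = below x n ρ
    where
    below : ∀ x n ρ → x *ᶻ n -ᶻ (ρ +ᶻ n *ᶻ x) ≡ - ρ
    below = solve-∀
  round-up : ∀ x n ρ α → α ≡ ρ +ᶻ n *ᶻ x → x *ᶻ (n +ᶻ + 1) -ᶻ α ≡ x -ᶻ ρ
  round-up x n ρ _ refl = above x n ρ
    where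
    above : ∀ x n ρ → x *ᶻ (n +ᶻ + 1) -ᶻ (ρ +ᶻ n *ᶻ x) ≡ x -ᶻ ρ
    above = solve-∀
  round : Dec (r ≤ K) → ∃[ n ] ∣ + d *ᶻ n -ᶻ α ∣ ≤ K
  round (yes r≤K) = quotient , (begin
    ∣ + d *ᶻ quotient -ᶻ α ∣          ≡⟨ cong ∣_∣ (round-down (+ d) quotient (+ r) α division) ⟩
    ∣ - (+ r) ∣                      ≡⟨ ℤP.∣-i∣≡∣i∣ (+ r) ⟩
    r                                ≤⟨ r≤K ⟩
    K                                ∎)
    where open ℕP.≤-Reasoning
  round (no r≰K) = quotient +ᶻ + 1 , (begin
    ∣ + d *ᶻ (quotient +ᶻ + 1) -ᶻ α ∣ ≡⟨ cong ∣_∣ (round-up (+ d) quotient (+ r) α division) ⟩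
    ∣ + d -ᶻ + r ∣                   ≡⟨ ∣+-+∣ (ℕP.<⇒≤ (n%ℕd<d α d)) ⟩
    d ∸ r                            ≤⟨ ℕP.∸-monoʳ-≤ d (ℕP.≰⇒> r≰K) ⟩
    K + K ∸ K                        ≡⟨ ℕP.m+n∸n≡m K K ⟩
    K                                ∎)
    where open ℕP.≤-Reasoning

nearest-multiple : ∀ γ α K → ∣ γ ∣ ≡ suc (K + K) → ∃[ n ] ∣ γ *ᶻ n -ᶻ α ∣ ≤ K
nearest-multiple (+ _) α K refl = nearest-multiple-pos α K
nearest-multiple -[1+ _ ] α K refl with nearest-multiple-pos α K
... | n , close =
  - n , ℕP.≤-trans (ℕP.≤-reflexive (cong ∣_∣ (negate-both (+ suc (K + K)) n α))) close
  where
  negate-both : ∀ x n α → (- x) *ᶻ (- n) -ᶻ α ≡ x *ᶻ n -ᶻ α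
  negate-both = solve-∀

module Lifts (P : LatticePolytope) (l₁ l₂ l : ℕ) (l₁≤l₂ : l₁ ≤ l₂) (l₂≤l : l₂ ≤ l)
  (wX : width P X ≡ l₁) (wY : width P Y ≡ l₂) (wZ : width P Z ≡ l)
  (diagonals : ∀ σ → Sign σ → l₂ ≤ width P (X ⊕ σ ⊛ Y)) where

  lift : ℤ → ℤ → Pt
  lift a b = a ⊛ X ⊕ b ⊛ Y ⊕ + 1 ⊛ Z

  -- x is no wider than y ± x, since l₁ ≤ l₂ and y - x = -(x - y).
  diagonals′ : ∀ σ → Sign σ → l₁ ≤ width P (Y ⊕ σ ⊛ X)
  diagonals′ σ (inj₁ refl) = ℕP.≤-trans l₁≤l₂ (ℕP.≤-trans (diagonals (+ 1) (inj₁ refl))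
    (ℕP.≤-reflexive (width-cong P (λ i → swap (X i) (Y i)))))
    where
    swap : ∀ x y → x +ᶻ + 1 *ᶻ y ≡ y +ᶻ + 1 *ᶻ x
    swap = solve-∀
  diagonals′ σ (inj₂ refl) = ℕP.≤-trans l₁≤l₂ (ℕP.≤-trans (diagonals (- (+ 1)) (inj₂ refl)) (begin
    width P (X ⊕ - (+ 1) ⊛ Y)               ≡⟨ ℕP.*-identityˡ _ ⟨
    ∣ - (+ 1) ∣ * width P (X ⊕ - (+ 1) ⊛ Y)  ≡⟨ width-⊛ P (- (+ 1)) (X ⊕ - (+ 1) ⊛ Y) ⟨
    width P (- (+ 1) ⊛ (X ⊕ - (+ 1) ⊛ Y))    ≡⟨ width-cong P (λ i → negate (X i) (Y i)) ⟩
    width P (Y ⊕ - (+ 1) ⊛ X)               ∎))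
    where
    open ℕP.≤-Reasoning
    negate : ∀ x y → - (+ 1) *ᶻ (x +ᶻ - (+ 1) *ᶻ y) ≡ y +ᶻ - (+ 1) *ᶻ x
    negate = solve-∀

  module XY = TwoFunctionals P X Y l₁ l₂ wX wY diagonals
  module YX = TwoFunctionals P Y X l₂ l₁ wY wX diagonals′

  first-condition-or-wide : ∀ a b →
    (∣ b ∣ ≤ ∣ a ∣ → Small ∣ a ∣ ∣ b ∣ l₁ l₂ l) ⊎ 2 * l ≤ width P (XY.comb a b)
  first-condition-or-wide a b with ∣ b ∣ ≤? ∣ a ∣
  ... | no b≰a = inj₁ (λ b≤a → contradiction b≤a b≰a)
  ... | yes b≤a = map₁ (λ small _ → small) (XY.small-or-wide l a b b≤a)

  second-condition-or-wide : ∀ a b →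
    (∣ a ∣ ≤ ∣ b ∣ → Small ∣ b ∣ ∣ a ∣ l₂ l₁ l) ⊎ 2 * l ≤ width P (XY.comb a b)
  second-condition-or-wide a b with ∣ a ∣ ≤? ∣ b ∣
  ... | no a≰b = inj₁ (λ a≤b → contradiction a≤b a≰b)
  ... | yes a≤b = map (λ small _ → small)
                      (λ wide → ℕP.≤-trans wide (ℕP.≤-reflexive (width-cong P swap)))
                      (YX.small-or-wide l b a a≤b)
    where
    swap : YX.comb b a ≗ XY.comb a b
    swap i = ℤP.+-comm (b *ᶻ Y i) (a *ᶻ X i)

  in-S-or-wide : ∀ a b →
    ((∣ b ∣ ≤ ∣ a ∣ → Small ∣ a ∣ ∣ b ∣ l₁ l₂ l) × (∣ a ∣ ≤ ∣ b ∣ → Small ∣ b ∣ ∣ a ∣ l₂ l₁ l))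
    ⊎ 2 * l ≤ width P (XY.comb a b)
  in-S-or-wide a b with first-condition-or-wide a b | second-condition-or-wide a b
  ... | inj₁ small₁ | inj₁ small₂ = inj₁ (small₁ , small₂)
  ... | inj₂ wide | _ = inj₂ wide
  ... | inj₁ _ | inj₂ wide = inj₂ wide

  -- Adding z changes the width by at most width z = l.
  lift-of-wide : ∀ a b → 2 * l ≤ width P (XY.comb a b) → l ≤ width P (lift a b)
  lift-of-wide a b wide = ℕP.+-cancelʳ-≤ l l (width P (lift a b)) (begin
    l + l                                ≡⟨ cong (λ e → l + e) (ℕP.+-identityʳ l) ⟨
    2 * l                                ≤⟨ wide ⟩
    width P (XY.comb a b)                ≡⟨ ℕP.*-identityˡ _ ⟨
    1 * width P (XY.comb a b)
      ≤⟨ width-relation P (+ 1) (- (+ 1)) (XY.comb a b) (lift a b) Z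
                        (λ i → drop-z (XY.comb a b i) (Z i)) ⟩
    width P (lift a b) + 1 * width P Z
      ≡⟨ cong (λ e → width P (lift a b) + e) (trans (ℕP.*-identityˡ _) wZ) ⟩
    width P (lift a b) + l               ∎)
    where
    open ℕP.≤-Reasoning
    drop-z : ∀ u z → + 1 *ᶻ u ≡ (u +ᶻ + 1 *ᶻ z) +ᶻ - (+ 1) *ᶻ z
    drop-z = solve-∀

  lifts-wide :
    (∀ a b → (∣ b ∣ ≤ ∣ a ∣ → Small ∣ a ∣ ∣ b ∣ l₁ l₂ l) →
             (∣ a ∣ ≤ ∣ b ∣ → Small ∣ b ∣ ∣ a ∣ l₂ l₁ l) → l ≤ width P (lift a b)) →
    ∀ a b → l ≤ width P (lift a b)
  lifts-wide wide-on-S a b with in-S-or-wide a b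
  ... | inj₁ (small₁ , small₂) = wide-on-S a b small₁ small₂
  ... | inj₂ wide = lift-of-wide a b wide

  -- A functional f with odd z-coefficient g = ±(2K+1) is l wide: rounding
  -- f₀/g, f₁/g to n, m gives g (n x + m y + z) = f + t x + u y with |t|, |u| ≤ K.
  odd-row-wide : (∀ a b → l ≤ width P (lift a b)) →
    ∀ f K → ∣ f 2F ∣ ≡ suc (K + K) → l ≤ width P f
  odd-row-wide lifts-l f K odd
    with nearest-multiple (f 2F) (f 0F) K odd | nearest-multiple (f 2F) (f 1F) K odd
  ... | n , ∣t∣≤K | m , ∣u∣≤K = ℕP.+-cancelʳ-≤ ((K + K) * l) l (width P f) (begin
    l + (K + K) * l                                  ≡⟨⟩
    suc (K + K) * l                                  ≡⟨ cong (_* l) odd ⟨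
    ∣ g ∣ * l                                        ≤⟨ ℕP.*-monoʳ-≤ ∣ g ∣ (lifts-l n m) ⟩
    ∣ g ∣ * width P (lift n m)
      ≤⟨ width-relation₃ P g t u (lift n m) f X Y relation ⟩
    width P f + ∣ t ∣ * width P X + ∣ u ∣ * width P Y
      ≡⟨ cong₂ (λ p q → width P f + ∣ t ∣ * p + ∣ u ∣ * q) wX wY ⟩
    width P f + ∣ t ∣ * l₁ + ∣ u ∣ * l₂
      ≤⟨ ℕP.+-mono-≤ (ℕP.+-monoʳ-≤ (width P f) (ℕP.*-mono-≤ ∣t∣≤K (ℕP.≤-trans l₁≤l₂ l₂≤l)))
                     (ℕP.*-mono-≤ ∣u∣≤K l₂≤l) ⟩
    width P f + K * l + K * l                        ≡⟨ ℕP.+-assoc (width P f) (K * l) (K * l) ⟩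
    width P f + (K * l + K * l)
      ≡⟨ cong (λ e → width P f + e) (ℕP.*-distribʳ-+ l K K) ⟨
    width P f + (K + K) * l                          ∎)
    where
    open ℕP.≤-Reasoning
    g t u : ℤ
    g = f 2F
    t = g *ᶻ n -ᶻ f 0F
    u = g *ᶻ m -ᶻ f 1F
    regroup : ∀ g n m f₀ f₁ x y z → g *ᶻ (n *ᶻ x +ᶻ m *ᶻ y +ᶻ + 1 *ᶻ z)
      ≡ (f₀ *ᶻ x +ᶻ f₁ *ᶻ y +ᶻ g *ᶻ z) +ᶻ (g *ᶻ n -ᶻ f₀) *ᶻ x +ᶻ (g *ᶻ m -ᶻ f₁) *ᶻ y
    regroup = solve-∀
    relation : g ⊛ lift n m ≗ f ⊕ t ⊛ X ⊕ u ⊛ Y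
    relation i = trans (regroup g n m (f 0F) (f 1F) (X i) (Y i) (Z i))
                       (cong (λ e → e +ᶻ t *ᶻ X i +ᶻ u *ᶻ Y i) (sym (coordinates f i)))

parity-split : ∀ n → (∃[ K ] n ≡ K + K) ⊎ (∃[ K ] n ≡ suc (K + K))
parity-split zero = inj₁ (0 , refl)
parity-split (suc n) with parity-split n
... | inj₁ (K , even) = inj₂ (K , cong suc even)
... | inj₂ (K , odd) = inj₁ (suc K , cong suc (trans odd (sym (ℕP.+-suc K K))))

even-integer : ∀ g K → ∣ g ∣ ≡ K + K → ∃[ h ] g ≡ + 2 *ᶻ h
even-integer (+ _) K refl = + K , sym (double (+ K))
  where
  double : ∀ x → + 2 *ᶻ x ≡ x +ᶻ x
  double = solve-∀
even-integer -[1+ _ ] K e = - (+ K) , trans (cong (λ n → - (+ n)) e) (sym (double-neg (+ K)))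
  where
  double-neg : ∀ x → + 2 *ᶻ (- x) ≡ - (x +ᶻ x)
  double-neg = solve-∀

-- det3 is linear in the last column; in particular it is even if that column is.
det3-even : ∀ A {h₀ h₁ h₂} →
  A 0F 2F ≡ + 2 *ᶻ h₀ → A 1F 2F ≡ + 2 *ᶻ h₁ → A 2F 2F ≡ + 2 *ᶻ h₂ → ∃[ R ] det3 A ≡ + 2 *ᶻ R
det3-even A = expansion (A 0F 0F) (A 0F 1F) (A 0F 2F) (A 1F 0F) (A 1F 1F) (A 1F 2F)
                        (A 2F 0F) (A 2F 1F) (A 2F 2F)
  where
  factor-two : ∀ a₀₀ a₀₁ a₁₀ a₁₁ a₂₀ a₂₁ h₀ h₁ h₂ →
    a₀₀ *ᶻ (a₁₁ *ᶻ (+ 2 *ᶻ h₂) -ᶻ (+ 2 *ᶻ h₁) *ᶻ a₂₁)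
      -ᶻ a₀₁ *ᶻ (a₁₀ *ᶻ (+ 2 *ᶻ h₂) -ᶻ (+ 2 *ᶻ h₁) *ᶻ a₂₀)
      +ᶻ (+ 2 *ᶻ h₀) *ᶻ (a₁₀ *ᶻ a₂₁ -ᶻ a₁₁ *ᶻ a₂₀)
    ≡ + 2 *ᶻ (a₀₀ *ᶻ (a₁₁ *ᶻ h₂ -ᶻ h₁ *ᶻ a₂₁) -ᶻ a₀₁ *ᶻ (a₁₀ *ᶻ h₂ -ᶻ h₁ *ᶻ a₂₀)
              +ᶻ h₀ *ᶻ (a₁₀ *ᶻ a₂₁ -ᶻ a₁₁ *ᶻ a₂₀))
  factor-two = solve-∀
  expansion : ∀ a₀₀ a₀₁ a₀₂ a₁₀ a₁₁ a₁₂ a₂₀ a₂₁ a₂₂ {h₀ h₁ h₂} →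
    a₀₂ ≡ + 2 *ᶻ h₀ → a₁₂ ≡ + 2 *ᶻ h₁ → a₂₂ ≡ + 2 *ᶻ h₂ →
    ∃[ R ] a₀₀ *ᶻ (a₁₁ *ᶻ a₂₂ -ᶻ a₁₂ *ᶻ a₂₁) -ᶻ a₀₁ *ᶻ (a₁₀ *ᶻ a₂₂ -ᶻ a₁₂ *ᶻ a₂₀)
             +ᶻ a₀₂ *ᶻ (a₁₀ *ᶻ a₂₁ -ᶻ a₁₁ *ᶻ a₂₀) ≡ + 2 *ᶻ R
  expansion a₀₀ a₀₁ _ a₁₀ a₁₁ _ a₂₀ a₂₁ _ {h₀} {h₁} {h₂} refl refl refl =
    _ , factor-two a₀₀ a₀₁ a₁₀ a₁₁ a₂₀ a₂₁ h₀ h₁ h₂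

unit-not-even : ∀ R → ∣ + 2 *ᶻ R ∣ ≡ 1 → ⊥
unit-not-even R e = ℕP.even≢odd ∣ R ∣ 0 (trans (sym (ℤP.abs-* (+ 2) R)) e)

unimodular-∣det∣ : ∀ A → Unimodular A → ∣ det3 A ∣ ≡ 1
unimodular-∣det∣ A (inj₁ det≡1) = cong ∣_∣ det≡1
unimodular-∣det∣ A (inj₂ det≡-1) = cong ∣_∣ det≡-1

odd-entry-row : ∀ A → Unimodular A → ∃[ i ] ∃[ K ] ∣ A i 2F ∣ ≡ suc (K + K)
odd-entry-row A unimodular
  with parity-split ∣ A 0F 2F ∣ | parity-split ∣ A 1F 2F ∣ | parity-split ∣ A 2F 2F ∣
... | inj₂ (K , odd) | _ | _ = 0F , K , odd
... | inj₁ _ | inj₂ (K , odd) | _ = 1F , K , odd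
... | inj₁ _ | inj₁ _ | inj₂ (K , odd) = 2F , K , odd
... | inj₁ (K₀ , even₀) | inj₁ (K₁ , even₁) | inj₁ (K₂ , even₂)
  with even-integer _ K₀ even₀ | even-integer _ K₁ even₁ | even-integer _ K₂ even₂
... | _ , e₀ | _ , e₁ | _ , e₂ with det3-even A e₀ e₁ e₂
... | R , det≡2R =
  ⊥-elim (unit-not-even R (trans (cong ∣_∣ (sym det≡2R)) (unimodular-∣det∣ A unimodular)))

fits⇒width≤ : ∀ P m A v → FitsInCube P m A v → ∀ i → width P (A i) ≤ m
fits⇒width≤ P m A v fits i with Δ-attained P (A i)
... | q , r , q∈ , r∈ , eq = ℤP.drop‿+≤+ (begin
  + width P (A i)                     ≡⟨ Δ≡width P (A i) ⟨
  Δ P (A i)                           ≡⟨ eq ⟩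
  spread (A i) q r                    ≡⟨ translate (evalLin (A i) q) (evalLin (A i) r) (v i) ⟩
  affine A v q i -ᶻ affine A v r i
    ≤⟨ ℤP.+-mono-≤ (proj₂ (lookup fits q∈ i)) (ℤP.neg-mono-≤ (proj₁ (lookup fits r∈ i))) ⟩
  + m -ᶻ + 0                          ≡⟨ ℤP.+-identityʳ (+ m) ⟩
  + m                                 ∎)
  where
  open ℤP.≤-Reasoning
  translate : ∀ x y w → x -ᶻ y ≡ (x +ᶻ w) -ᶻ (y +ᶻ w)
  translate = solve-∀

fits-after-shift : ∀ P A k → (∀ i → Δ P (A i) ≤ᶻ + k) → FitsInCube P k A (λ i → - minOn P (A i))
fits-after-shift P@(p ∷ ps) A k narrow = tabulate λ q∈ i →
  ℤP.i≤j⇒0≤j-i (minOn-lower p ps (A i) q∈) ,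
  ℤP.≤-trans (ℤP.+-monoˡ-≤ (- minOn P (A i)) (maxOn-upper p ps (A i) q∈)) (narrow i)

identity : Mat
identity 0F = X
identity 1F = Y
identity 2F = Z

-- The theorem.  The argument does not use the hypothesis 1 ≤ l₁.

mainTheorem8 : (P : LatticePolytope) (l₁ l₂ l : ℕ) →
    1 ≤ l₁ → l₁ ≤ l₂ → l₂ ≤ l →
    Δ P (vec3 (+ 1) (+ 0) (+ 0)) ≡ + l₁ →
    Δ P (vec3 (+ 0) (+ 1) (+ 0)) ≡ + l₂ →
    Δ P (vec3 (+ 0) (+ 0) (+ 1)) ≡ + l →
    Data.Integer._≤_ (+ l₂) (Δ P (vec3 (+ 1) (+ 1) (+ 0))) →
    Data.Integer._≤_ (+ l₂) (Δ P (vec3 (+ 1) (- (+ 1)) (+ 0))) →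
    (∀ (a b : ℤ) →
      (∣ b ∣ ≤ ∣ a ∣ →
        (∣ b ∣ Data.Nat.* l₂ ≤ 2 Data.Nat.* l ∸ 1)
        × (∣ a ∣ Data.Nat.* l₁ ≤ 2 Data.Nat.* l ∸ 1 Data.Nat.+ ∣ b ∣ Data.Nat.* l₂)) →
      (∣ a ∣ ≤ ∣ b ∣ →
        (∣ a ∣ Data.Nat.* l₁ ≤ 2 Data.Nat.* l ∸ 1)
        × (∣ b ∣ Data.Nat.* l₂ ≤ 2 Data.Nat.* l ∸ 1 Data.Nat.+ ∣ a ∣ Data.Nat.* l₁)) →
      Data.Integer._≤_ (+ l) (Δ P (vec3 a b (+ 1)))) →
    IsLatticeSize P l
mainTheorem8 P l₁ l₂ l _ l₁≤l₂ l₂≤l Δx Δy Δz Δx+y Δx-y wide-on-S =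
  (identity , (λ i → - minOn P (identity i)) , inj₁ refl , fits-after-shift P identity l rows≤l) ,
  minimal
  where
  diagonals : ∀ σ → Sign σ → l₂ ≤ width P (X ⊕ σ ⊛ Y)
  diagonals _ (inj₁ refl) = ℕP.≤-trans (width≥ P (vec3 (+ 1) (+ 1) (+ 0)) Δx+y)
    (ℕP.≤-reflexive (width-cong P sum-coords))
  diagonals _ (inj₂ refl) = ℕP.≤-trans (width≥ P (vec3 (+ 1) (- (+ 1)) (+ 0)) Δx-y)
    (ℕP.≤-reflexive (width-cong P difference-coords))

  open Lifts P l₁ l₂ l l₁≤l₂ l₂≤l (cong ∣_∣ Δx) (cong ∣_∣ Δy) (cong ∣_∣ Δz) diagonals

  all-lifts-wide : ∀ a b → l ≤ width P (lift a b)
  all-lifts-wide = lifts-wide λ a b small₁ small₂ → ℕP.≤-trans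
    (width≥ P (vec3 a b (+ 1)) (wide-on-S a b small₁ small₂))
    (ℕP.≤-reflexive (width-cong P (coordinates (vec3 a b (+ 1)))))

  rows≤l : ∀ i → Δ P (identity i) ≤ᶻ + l
  rows≤l 0F = ℤP.≤-trans (ℤP.≤-reflexive Δx) (+≤+ (ℕP.≤-trans l₁≤l₂ l₂≤l))
  rows≤l 1F = ℤP.≤-trans (ℤP.≤-reflexive Δy) (+≤+ l₂≤l)
  rows≤l 2F = ℤP.≤-reflexive Δz

  -- Lower bound: the row with odd last entry is l wide, and at most m wide.
  minimal : ∀ m A v → Unimodular A → FitsInCube P m A v → l ≤ m
  minimal m A v unimodular fits with odd-entry-row A unimodular
  ... | i , K , odd =
    ℕP.≤-trans (odd-row-wide all-lifts-wide (A i) K odd) (fits⇒width≤ P m A v fits i)
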